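{- Let $G$ be a graph with $h_1(G)=1$. If a tree tentacle $T$ of $G$ is such that $\overline T$ is spherical, then $\overline G$ is simple.
   Context: $h_1(G)=\kappa+|E|-|V|$ ($\kappa$ = number of components), so $G$ has a unique cycle $C$. For each vertex $v$ of $C$, the tree tentacles at $v$ are the trees $T$ attached to $v$: each is obtained from a connected component $K$ of the graph (component of $v$ in $G$ with the edges of $C$ removed) minus $v$, by adding back $v$ and its edge to $K$; so $v$ is a leaf of $T$ identified with $v$. For a graph on vertex set $X=\{x_1,\ldots,x_n\}$, the edge ideal $\overline G\subset\mathbb{Z}[X]$ is generated by the $x_i^2$ and $x_ix_j$ for edges; ideals are identified with their extensions by extra variables. For a monomial ideal $I$ containing all squares of variables: $R(I)$ is the complex of monomials not in $I$; $(I:x)=\{m:xm\in I\}$; $R(I)$ is a cone with apex $a$ if $(I:a)=(I,a)$; $a$ dominates $b$ in $I$ if $R(I)$ is not a cone with apex $b$ but $R((I,a))$ is. A sequence $(a_1,\ldots,a_r)$ with $I_i=(I:a_1\cdots a_{i-1})$ is a resolution if for all $i\in[r]$, $a_i\notin I_i$ and either $R(I_i)$ is a cone with apex $a_i$ or $a_i$ dominates some variable in $I_i$; maximal if not extendable; its core is $I_{r+1}$; it is spherical if no $R(I_i)$ ($i\in[r]$) is a cone with apex $a_i$. $I$ is spherical if it admits a spherical maximal resolution, and simple if $(x_1,\ldots,x_n)$ is the core of some maximal resolution. -}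

module Defs where

open import Data.Nat using (ℕ; zero; suc; _+_; _≤_; _<ᵇ_)
open import Data.Fin using (Fin; toℕ)
open import Data.Bool using (Bool; true; false; _∧_; if_then_else_)
open import Data.List using (List; []; _∷_; map; allFin)
open import Data.Nat.ListAction using (sum)
open import Data.Product using (Σ; ∃; _×_; _,_)
open import Data.Sum using (_⊎_)
open import Data.Unit using (⊤)
open import Relation.Nullary using (¬_)
open import Relation.Binary.PropositionalEquality using (_≡_; _≢_)
open import Relation.Binary.Construct.Closure.ReflexiveTransitive using (Star)

_⇔_ : Set → Set → Set
A ⇔ B = (A → B) × (B → A)

record Graph (n : ℕ) : Set where
  field
    adj    : Fin n → Fin n → Bool
    sym    : ∀ i j → adj i j ≡ adj j i
    irrefl : ∀ i → adj i i ≡ false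
open Graph public

Adj : ∀ {n} → Graph n → Fin n → Fin n → Set
Adj G i j = adj G i j ≡ true

numEdges : ∀ {n} → Graph n → ℕ
numEdges {n} G =
  sum (map (λ i → sum (map (λ j → if (toℕ i <ᵇ toℕ j) ∧ adj G i j then 1 else 0)
                             (allFin n)))
           (allFin n))

-- κ is the number of connected components of G: there is a surjection
-- from the vertices onto Fin κ whose fibres are exactly the components.
IsComponentCount : ∀ {n} → Graph n → ℕ → Set
IsComponentCount {n} G κ =
  Σ (Fin n → Fin κ) λ f →
    (∀ c → ∃ λ i → f i ≡ c) ×
    (∀ i j → (f i ≡ f j) ⇔ Star (Adj G) i j)

record Cycle {n : ℕ} (G : Graph n) : Set where
  field
    L        : ℕ
    L≥2      : 2 ≤ L
    vert     : Fin (suc L) → Fin n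
    inj      : ∀ i j → vert i ≡ vert j → i ≡ j
  CStep : Fin (suc L) → Fin (suc L) → Set
  CStep i j = (toℕ j ≡ suc (toℕ i)) ⊎ ((toℕ i ≡ L) × (toℕ j ≡ 0))
  field
    closed   : ∀ i j → CStep i j → Adj G (vert i) (vert j)
  CEdge : Fin n → Fin n → Set
  CEdge u w = Σ (Fin (suc L)) λ i → Σ (Fin (suc L)) λ j → CStep i j ×
              (((vert i ≡ u) × (vert j ≡ w)) ⊎ ((vert i ≡ w) × (vert j ≡ u)))
open Cycle public

-- G' = G with the edges of the cycle C removed.
-- For a vertex v of C and a neighbour w of v in G', the set K of vertices
-- reachable from w in G' - v is a component of (component of v in G') - v,
-- and every such component arises this way.  The tentacle T is K ∪ {v}
-- with the edges of K together with the edges from v to K, i.e. the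
-- subgraph of G' induced on K ∪ {v}.

module _ {n : ℕ} (G : Graph n) (C : Cycle G) where
  AdjMinusC : Fin n → Fin n → Set
  AdjMinusC u w = Adj G u w × ¬ CEdge C u w

  AdjMinusCAvoid : Fin n → Fin n → Fin n → Set
  AdjMinusCAvoid v u w = AdjMinusC u w × (u ≢ v) × (w ≢ v)

record TreeTentacle {n k : ℕ} (G : Graph n) (T : Graph k) : Set where
  field
    C     : Cycle G
    pos   : Fin (suc (L C))
    w     : Fin n
  v : Fin n
  v = vert C pos
  field
    vw    : AdjMinusC G C v w
    ι     : Fin k → Fin n
    ι-inj : ∀ i j → ι i ≡ ι j → i ≡ j
    image : ∀ u → (∃ λ i → ι i ≡ u) ⇔ ((u ≡ v) ⊎ Star (AdjMinusCAvoid G C v) w u)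
    edges : ∀ i j → Adj T i j ⇔ AdjMinusC G C (ι i) (ι j)

-- Monomials in ℤ[x₀,…,x_{n-1}] (exponent vectors) and monomial ideals
-- (given by the set of monomials they contain).

Mon : ℕ → Set
Mon n = Fin n → ℕ

MonIdeal : ℕ → Set₁
MonIdeal n = Mon n → Set

_*x_ : ∀ {n} → Mon n → Fin n → Mon n
(m *x a) b with Data.Fin._≟_ a b
... | Relation.Nullary.yes _ = suc (m b)
... | Relation.Nullary.no  _ = m b

var : ∀ {n} → Fin n → Mon n
var a = (λ _ → 0) *x a

_∋x_ : ∀ {n} → MonIdeal n → Fin n → Set
I ∋x a = I (var a)

_≐_ : ∀ {n} → MonIdeal n → MonIdeal n → Set
I ≐ J = ∀ m → I m ⇔ J m

edgeIdeal : ∀ {n} → Graph n → MonIdeal n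
edgeIdeal G m = (∃ λ i → 2 ≤ m i) ⊎ (∃ λ i → ∃ λ j → Adj G i j × (1 ≤ m i) × (1 ≤ m j))

maxIdeal : ∀ {n} → MonIdeal n
maxIdeal m = ∃ λ i → 1 ≤ m i

_∶_ : ∀ {n} → MonIdeal n → Fin n → MonIdeal n
(I ∶ a) m = I (m *x a)

_,,_ : ∀ {n} → MonIdeal n → Fin n → MonIdeal n
(I ,, a) m = (1 ≤ m a) ⊎ I m

IsCone : ∀ {n} → MonIdeal n → Fin n → Set
IsCone I a = (I ∶ a) ≐ (I ,, a)

Dominates : ∀ {n} → MonIdeal n → Fin n → Fin n → Set
Dominates I a b = ¬ IsCone I b × IsCone (I ,, a) b

Step : ∀ {n} → MonIdeal n → Fin n → Set
Step {n} I a = ¬ (I ∋x a) × (IsCone I a ⊎ Σ (Fin n) (Dominates I a))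

SphStep : ∀ {n} → MonIdeal n → Fin n → Set
SphStep I a = Step I a × ¬ IsCone I a

-- (a₁,…,a_r) is a resolution of I w.r.t. the step condition S, where
-- I_{i+1} = (I_i : a_i) = (I : a₁⋯a_i)
IsRes : ∀ {n} → (MonIdeal n → Fin n → Set) → MonIdeal n → List (Fin n) → Set
IsRes S I []       = ⊤
IsRes S I (a ∷ as) = S I a × IsRes S (I ∶ a) as

core : ∀ {n} → MonIdeal n → List (Fin n) → MonIdeal n
core I []       = I
core I (a ∷ as) = core (I ∶ a) as

IsMaximal : ∀ {n} → MonIdeal n → List (Fin n) → Set
IsMaximal {n} I as = ¬ Σ (Fin n) (Step (core I as))

Spherical : ∀ {n} → MonIdeal n → Set
Spherical {n} I = Σ (List (Fin n)) λ as → IsRes SphStep I as × IsMaximal I as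

Simple : ∀ {n} → MonIdeal n → Set
Simple {n} I = Σ (List (Fin n)) λ as →
  IsRes Step I as × IsMaximal I as × (core I as ≐ maxIdeal)

-- Colon ideals of an edge ideal are edge ideals with some variables adjoined, so a
-- resolution of an edge ideal only tracks the set of alive vertices: an alive
-- vertex without alive neighbours is a cone apex, the neighbour of a leaf dominates
-- the leaf, and either step deletes a closed neighbourhood. In an acyclic graph one of
-- these steps is available until no vertex is alive, which makes the ideal simple.
-- By h₁(G) = 1 the only cycle of G is C, which meets the tentacle T only at its root v.
-- The alternating count χ of independent sets is negated by a leaf step and vanishes when
-- a vertex is isolated; a spherical resolution of T consists of leaf steps and ends at
-- χ = 1, so χ(T) ≠ 0. Hence while v is alive, the leaf steps of T away from v can be run
-- in G and v never becomes isolated in T; once v is deleted, the rest of G is acyclic.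

module Submission where

open import Defs
open import Data.Nat using (ℕ; suc; _+_)
open import Relation.Binary.PropositionalEquality using (_≡_)

open import Data.Bool using (Bool; true; false; _∧_; _∨_; not; if_then_else_)
open import Data.Bool.Properties as Boolₚ using (T-≡; not-¬)
open import Data.Empty using (⊥-elim)
open import Data.Fin as Fin using (Fin; toℕ; fromℕ; inject₁)
open import Data.Fin.Properties as Finₚ using (_≟_)
open import Data.Integer using (ℤ; _-_; -_; 0ℤ; 1ℤ)
import Data.Integer.Properties as ℤₚ
open import Data.Integer.Tactic.RingSolver using (solve-∀)
open import Data.List using (List; []; _∷_; [_]; length; map; concatMap; filter; allFin)
open import Data.List.Membership.Propositional using (_∈_; lose)
open import Data.List.Membership.Propositional.Properties using (∈-allFin; ∈-filter⁺; ∈-concatMap⁺)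
open import Data.List.Properties using (length-++; map-cong; filter-notAll)
open import Data.List.Relation.Unary.Any using (here; there)
open import Data.Nat as ℕ using (zero; _≤_; _<_; z≤n; s≤s)
open import Data.Nat.Induction using (<-wellFounded)
open import Data.Nat.ListAction using (sum)
open import Data.Nat.Properties as ℕₚ using ()
open import Data.Product using (∃; ∃₂; _×_; _,_; proj₁; proj₂)
open import Data.Sum using (_⊎_; inj₁; inj₂; [_,_]′; map₂)
open import Function using (_∘_; Equivalence)
open import Induction.WellFounded using (Acc; acc)
open import Relation.Binary using (tri<; tri≈; tri>)
open import Relation.Binary.Construct.Closure.ReflexiveTransitive as Star using (Star; ε; _◅_; _◅◅_)
open import Relation.Binary.PropositionalEquality as ≡ using (refl; cong; cong₂; subst; _≢_)
open import Relation.Nullary using (¬_; Dec; yes; no; does; _×-dec_; _⊎-dec_; ¬?)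
open import Relation.Nullary.Decidable using (dec-true; dec-false; toSum)

module _ {n : ℕ} (G : Graph n) where

  adj-sym : ∀ {a b} → Adj G a b → Adj G b a
  adj-sym {a} {b} ab = ≡.trans (Graph.sym G b a) ab

  adj⇒≢ : ∀ {a b} → Adj G a b → a ≢ b
  adj⇒≢ {a} ab refl with ≡.trans (≡.sym ab) (irrefl G a)
  ... | ()

SameEdge : {A : Set} → A → A → A → A → Set
SameEdge p q c d = (p ≡ c × q ≡ d) ⊎ (p ≡ d × q ≡ c)

sameEdge? : ∀ {m} (p q c d : Fin m) → Dec (SameEdge p q c d)
sameEdge? p q c d = (p ≟ c ×-dec q ≟ d) ⊎-dec (p ≟ d ×-dec q ≟ c)

module _ {A : Set} {p q c d : A} where

  SameEdge-swapˡ : SameEdge p q c d → SameEdge q p c d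
  SameEdge-swapˡ (inj₁ (e₁ , e₂)) = inj₂ (e₂ , e₁)
  SameEdge-swapˡ (inj₂ (e₁ , e₂)) = inj₁ (e₂ , e₁)

  SameEdge-swapʳ : SameEdge p q c d → SameEdge p q d c
  SameEdge-swapʳ (inj₁ e) = inj₂ e
  SameEdge-swapʳ (inj₂ e) = inj₁ e

  SameEdge-sym : SameEdge p q c d → SameEdge c d p q
  SameEdge-sym (inj₁ (refl , refl)) = inj₁ (refl , refl)
  SameEdge-sym (inj₂ (refl , refl)) = inj₂ (refl , refl)

SameEdge-trans : {A : Set} {p q c d x y : A} → SameEdge x y p q → SameEdge p q c d → SameEdge x y c d
SameEdge-trans (inj₁ (refl , refl)) e = e
SameEdge-trans (inj₂ (refl , refl)) e = SameEdge-swapˡ e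

SameEdge-suc : ∀ {t a} → SameEdge t (suc t) a (suc a) → t ≡ a
SameEdge-suc (inj₁ (t≡a , _))     = t≡a
SameEdge-suc (inj₂ (refl , st≡a)) = ⊥-elim (ℕₚ.<⇒≢ (ℕₚ.n≤1+n _) (cong suc (≡.sym st≡a)))

-- Counting vertices, edges and components

module _ {n : ℕ} where

  -- connectivity along the listed edges, by recursion on the list so that it is decidable
  Linked : List (Fin n × Fin n) → Fin n → Fin n → Set
  Linked []             i j = i ≡ j
  Linked ((a , b) ∷ es) i j =
    Linked es i j ⊎ (Linked es i a × Linked es b j) ⊎ (Linked es i b × Linked es a j)

  linked? : ∀ es i j → Dec (Linked es i j)
  linked? []             i j = i ≟ j
  linked? ((a , b) ∷ es) i j =
    linked? es i j ⊎-dec ((linked? es i a ×-dec linked? es b j) ⊎-dec (linked? es i b ×-dec linked? es a j))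

  Linked-refl : ∀ es i → Linked es i i
  Linked-refl []       i = refl
  Linked-refl (_ ∷ es) i = inj₁ (Linked-refl es i)

  Linked-sym : ∀ es {i j} → Linked es i j → Linked es j i
  Linked-sym []       e                     = ≡.sym e
  Linked-sym (_ ∷ es) (inj₁ p)              = inj₁ (Linked-sym es p)
  Linked-sym (_ ∷ es) (inj₂ (inj₁ (p , q))) = inj₂ (inj₂ (Linked-sym es q , Linked-sym es p))
  Linked-sym (_ ∷ es) (inj₂ (inj₂ (p , q))) = inj₂ (inj₁ (Linked-sym es q , Linked-sym es p))

  Linked-trans : ∀ es {i j k} → Linked es i j → Linked es j k → Linked es i k
  Linked-trans []       e₁ e₂ = ≡.trans e₁ e₂
  Linked-trans (_ ∷ es) (inj₁ p)              (inj₁ q)              = inj₁ (Linked-trans es p q)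
  Linked-trans (_ ∷ es) (inj₁ p)              (inj₂ (inj₁ (q , r))) = inj₂ (inj₁ (Linked-trans es p q , r))
  Linked-trans (_ ∷ es) (inj₁ p)              (inj₂ (inj₂ (q , r))) = inj₂ (inj₂ (Linked-trans es p q , r))
  Linked-trans (_ ∷ es) (inj₂ (inj₁ (p , q))) (inj₁ r)              = inj₂ (inj₁ (p , Linked-trans es q r))
  Linked-trans (_ ∷ es) (inj₂ (inj₁ (p , _))) (inj₂ (inj₁ (_ , s))) = inj₂ (inj₁ (p , s))
  Linked-trans (_ ∷ es) (inj₂ (inj₁ (p , _))) (inj₂ (inj₂ (_ , s))) = inj₁ (Linked-trans es p s)
  Linked-trans (_ ∷ es) (inj₂ (inj₂ (p , q))) (inj₁ r)              = inj₂ (inj₂ (p , Linked-trans es q r))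
  Linked-trans (_ ∷ es) (inj₂ (inj₂ (p , _))) (inj₂ (inj₁ (_ , s))) = inj₁ (Linked-trans es p s)
  Linked-trans (_ ∷ es) (inj₂ (inj₂ (p , _))) (inj₂ (inj₂ (_ , s))) = inj₂ (inj₂ (p , s))

  ∈⇒Linked : ∀ es {a b} → (a , b) ∈ es → Linked es a b
  ∈⇒Linked ((a , b) ∷ es) (here refl) = inj₂ (inj₁ (Linked-refl es a , Linked-refl es b))
  ∈⇒Linked (_ ∷ es)       (there m)   = inj₁ (∈⇒Linked es m)

  Linked-resp-SameEdge : ∀ es {a b p q} → SameEdge a b p q → Linked es a b → Linked es p q
  Linked-resp-SameEdge es (inj₁ (refl , refl)) l = l
  Linked-resp-SameEdge es (inj₂ (refl , refl)) l = Linked-sym es l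

  Star⇒Linked : ∀ es {R : Fin n → Fin n → Set} → (∀ {p q} → R p q → Linked es p q) →
                ∀ {i j} → Star R i j → Linked es i j
  Star⇒Linked es link = Star.fold (Linked es) (λ r l → Linked-trans es (link r) l) (Linked-refl es _)

  -- Without the edge ab, the vertices still linked to b form one new class.
  n≤κ+length : ∀ es κ (f : Fin n → Fin κ) → (∀ i j → f i ≡ f j → Linked es i j) → n ≤ κ + length es
  n≤κ+length [] κ f linked =
    subst (n ≤_) (≡.sym (ℕₚ.+-identityʳ κ)) (Finₚ.injective⇒≤ λ {i} {j} → linked i j)
  n≤κ+length ((a , b) ∷ es) κ f linked =
    subst (n ≤_) (≡.sym (ℕₚ.+-suc κ (length es))) (n≤κ+length es (suc κ) f′ linked′)
    where
    class : ∀ {P : Set} → Dec P → Fin κ → Fin (suc κ)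
    class (yes _) _ = fromℕ κ
    class (no _)  c = inject₁ c
    f′ : Fin n → Fin (suc κ)
    f′ i = class (linked? es i b) (f i)
    linked′ : ∀ i j → f′ i ≡ f′ j → Linked es i j
    linked′ i j e with linked? es i b | linked? es j b
    ... | yes ib | yes jb = Linked-trans es ib (Linked-sym es jb)
    ... | yes _  | no _   = ⊥-elim (Finₚ.fromℕ≢inject₁ e)
    ... | no _   | yes _  = ⊥-elim (Finₚ.fromℕ≢inject₁ (≡.sym e))
    ... | no ¬ib | no ¬jb with linked i j (Finₚ.inject₁-injective e)
    ...   | inj₁ ij               = ij
    ...   | inj₂ (inj₁ (_ , bj))  = ⊥-elim (¬jb (Linked-sym es bj))
    ...   | inj₂ (inj₂ (ib , _))  = ⊥-elim (¬ib ib)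

length-concatMap : {A B : Set} (f : A → List B) (xs : List A) →
                   length (concatMap f xs) ≡ sum (map (length ∘ f) xs)
length-concatMap f []       = refl
length-concatMap f (x ∷ xs) = ≡.trans (length-++ (f x)) (cong (length (f x) +_) (length-concatMap f xs))

module _ {n : ℕ} (G : Graph n) where

  ascending? : Fin n → Fin n → Bool
  ascending? i j = (toℕ i ℕ.<ᵇ toℕ j) ∧ adj G i j

  ascendingEdge : Fin n → Fin n → List (Fin n × Fin n)
  ascendingEdge i j = if ascending? i j then [ (i , j) ] else []

  -- mirrors the double sum defining numEdges
  edgeList : List (Fin n × Fin n)
  edgeList = concatMap (λ i → concatMap (ascendingEdge i) (allFin n)) (allFin n)

  length-edgeList : length edgeList ≡ numEdges G
  length-edgeList = begin
    length edgeList
      ≡⟨ length-concatMap _ (allFin n) ⟩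
    sum (map (λ i → length (concatMap (ascendingEdge i) (allFin n))) (allFin n))
      ≡⟨ cong sum (map-cong (λ i → length-concatMap (ascendingEdge i) (allFin n)) (allFin n)) ⟩
    sum (map (λ i → sum (map (length ∘ ascendingEdge i) (allFin n))) (allFin n))
      ≡⟨ cong sum (map-cong (λ i → cong sum (map-cong (length-ascendingEdge i) (allFin n))) (allFin n)) ⟩
    numEdges G
      ∎
    where
    open ≡.≡-Reasoning
    length-ascendingEdge : ∀ i j → length (ascendingEdge i j) ≡ (if ascending? i j then 1 else 0)
    length-ascendingEdge i j with ascending? i j
    ... | true  = refl
    ... | false = refl

  ∈-edgeList : ∀ {a b} → Adj G a b → toℕ a < toℕ b → (a , b) ∈ edgeList
  ∈-edgeList {a} {b} ab a<b =
    ∈-concatMap⁺ _ (lose (∈-allFin a) (∈-concatMap⁺ (ascendingEdge a) (lose (∈-allFin b) ab∈)))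
    where
    ab∈ : (a , b) ∈ ascendingEdge a b
    ab∈ rewrite Equivalence.to T-≡ (ℕₚ.<⇒<ᵇ a<b) | ab = here refl

  edgeList-covers : ∀ {a b} → Adj G a b → ∃ λ e → e ∈ edgeList × SameEdge (proj₁ e) (proj₂ e) a b
  edgeList-covers {a} {b} ab with ℕₚ.<-cmp (toℕ a) (toℕ b)
  ... | tri< a<b _ _ = (a , b) , ∈-edgeList ab a<b , inj₁ (refl , refl)
  ... | tri≈ _ a≡b _ = ⊥-elim (adj⇒≢ G ab (Finₚ.toℕ-injective a≡b))
  ... | tri> _ _ b<a = (b , a) , ∈-edgeList (adj-sym G ab) b<a , inj₂ (refl , refl)

module _ {n : ℕ} (G : Graph n) where

  AdjExcept : Fin n → Fin n → Fin n → Fin n → Set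
  AdjExcept c d p q = Adj G p q × ¬ SameEdge p q c d

  module WithoutEdges (c₁ c₂ x y : Fin n) where

    private
      notXY? : (e : Fin n × Fin n) → Dec (¬ SameEdge (proj₁ e) (proj₂ e) x y)
      notXY? (p , q) = ¬? (sameEdge? p q x y)

      notC? : (e : Fin n × Fin n) → Dec (¬ SameEdge (proj₁ e) (proj₂ e) c₁ c₂)
      notC? (p , q) = ¬? (sameEdge? p q c₁ c₂)

      withoutXY : List (Fin n × Fin n)
      withoutXY = filter notXY? (edgeList G)

    remaining : List (Fin n × Fin n)
    remaining = filter notC? withoutXY

    Linked-remaining : ∀ {p q} → Adj G p q → ¬ SameEdge p q c₁ c₂ → ¬ SameEdge p q x y → Linked remaining p q
    Linked-remaining {p} {q} pq pq≉c pq≉xy with edgeList-covers G pq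
    ... | (a , b) , ab∈ , ab≈pq =
      Linked-resp-SameEdge remaining ab≈pq
        (∈⇒Linked remaining (∈-filter⁺ notC? (∈-filter⁺ notXY? ab∈ (pq≉xy ∘ pq≈)) (pq≉c ∘ pq≈)))
      where
      pq≈ : ∀ {c d} → SameEdge a b c d → SameEdge p q c d
      pq≈ = SameEdge-trans (SameEdge-sym ab≈pq)

    length-remaining : Adj G c₁ c₂ → Adj G x y → ¬ SameEdge x y c₁ c₂ →
                       suc (suc (length remaining)) ≤ numEdges G
    length-remaining c₁c₂ xy xy≉c with edgeList-covers G c₁c₂ | edgeList-covers G xy
    ... | ec , ec∈ , ec≈c | exy , exy∈ , exy≈xy =
      ℕₚ.≤-trans (ℕₚ.<-≤-trans (s≤s remaining<) withoutXY<) (ℕₚ.≤-reflexive (length-edgeList G))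
      where
      ec∈withoutXY : ec ∈ withoutXY
      ec∈withoutXY = ∈-filter⁺ notXY? ec∈ (λ ec≈xy → xy≉c (SameEdge-trans (SameEdge-sym ec≈xy) ec≈c))
      remaining< : length remaining < length withoutXY
      remaining< = filter-notAll notC? withoutXY (lose ec∈withoutXY (λ ec≉c → ec≉c ec≈c))
      withoutXY< : length withoutXY < length (edgeList G)
      withoutXY< = filter-notAll notXY? (edgeList G) (lose exy∈ (λ exy≉xy → exy≉xy exy≈xy))

  module _ {κ : ℕ} (cc : IsComponentCount G κ) (h₁≡1 : κ + numEdges G ≡ suc n) where

    -- Deleting both edges keeps every component connected, so n ≤ κ + (numEdges G ∸ 2) = n ∸ 1.
    no-second-cycle : ∀ {c₁ c₂ x y} → Adj G c₁ c₂ → Adj G x y → ¬ SameEdge x y c₁ c₂ →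
                      Star (AdjExcept c₁ c₂) c₂ c₁ →
                      ¬ Star (λ p q → AdjExcept c₁ c₂ p q × ¬ SameEdge p q x y) y x
    no-second-cycle {c₁} {c₂} {x} {y} c₁c₂ xy xy≉c c₂⇝c₁ y⇝x = ℕₚ.<-irrefl refl (begin
      suc (suc n)                      ≤⟨ s≤s (s≤s n≤κ+remaining) ⟩
      suc (suc (κ + length remaining)) ≡⟨ cong suc (ℕₚ.+-suc κ _) ⟨
      suc (κ + suc (length remaining)) ≡⟨ ℕₚ.+-suc κ _ ⟨
      κ + suc (suc (length remaining)) ≤⟨ ℕₚ.+-monoʳ-≤ κ (length-remaining c₁c₂ xy xy≉c) ⟩
      κ + numEdges G                   ≡⟨ h₁≡1 ⟩
      suc n                            ∎)
      where
      open ℕₚ.≤-Reasoning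
      open WithoutEdges c₁ c₂ x y

      linked-yx : Linked remaining y x
      linked-yx = Star⇒Linked remaining (λ ((pq , pq≉c) , pq≉xy) → Linked-remaining pq pq≉c pq≉xy) y⇝x

      linked-off-c : ∀ {p q} → AdjExcept c₁ c₂ p q → Linked remaining p q
      linked-off-c {p} {q} (pq , pq≉c) with sameEdge? p q x y
      ... | yes pq≈xy = Linked-resp-SameEdge remaining (SameEdge-swapˡ (SameEdge-sym pq≈xy)) linked-yx
      ... | no pq≉xy  = Linked-remaining pq pq≉c pq≉xy

      linked-adj : ∀ {p q} → Adj G p q → Linked remaining p q
      linked-adj {p} {q} pq with sameEdge? p q c₁ c₂
      ... | yes pq≈c = Linked-resp-SameEdge remaining (SameEdge-swapˡ (SameEdge-sym pq≈c))
                         (Star⇒Linked remaining linked-off-c c₂⇝c₁)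
      ... | no pq≉c  = linked-off-c (pq , pq≉c)

      n≤κ+remaining : n ≤ κ + length remaining
      n≤κ+remaining = n≤κ+length remaining κ (proj₁ cc) λ i j fi≡fj →
        Star⇒Linked remaining linked-adj (proj₁ (proj₂ (proj₂ cc) i j) fi≡fj)

-- Walks around the cycle

module CycleWalks {n : ℕ} {G : Graph n} (C : Cycle G) where

  -- out-of-range positions are sent to 0
  position : ℕ → Fin (suc (L C))
  position t with t ℕ.≤? L C
  ... | yes t≤L = Fin.fromℕ< (s≤s t≤L)
  ... | no _    = Fin.zero

  toℕ-position : ∀ {t} → t ≤ L C → toℕ (position t) ≡ t
  toℕ-position {t} t≤L with t ℕ.≤? L C
  ... | yes t≤L′ = Finₚ.toℕ-fromℕ< (s≤s t≤L′)
  ... | no t≰L   = ⊥-elim (t≰L t≤L)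

  toℕ≤L : ∀ p → toℕ p ≤ L C
  toℕ≤L p = ℕₚ.≤-pred (Finₚ.toℕ<n p)

  position-toℕ : ∀ p → position (toℕ p) ≡ p
  position-toℕ p = Finₚ.toℕ-injective (toℕ-position (toℕ≤L p))

  at : ℕ → Fin n
  at t = vert C (position t)

  vert≡at : ∀ p → vert C p ≡ at (toℕ p)
  vert≡at p = cong (vert C) (≡.sym (position-toℕ p))

  at-injective : ∀ {s t} → s ≤ L C → t ≤ L C → at s ≡ at t → s ≡ t
  at-injective s≤L t≤L e =
    ≡.trans (≡.sym (toℕ-position s≤L)) (≡.trans (cong toℕ (inj C _ _ e)) (toℕ-position t≤L))

  at-SameEdge : ∀ {s t a b} → s ≤ L C → t ≤ L C → a ≤ L C → b ≤ L C →
                SameEdge (at s) (at t) (at a) (at b) → SameEdge s t a b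
  at-SameEdge s≤L t≤L a≤L b≤L (inj₁ (sa , tb)) = inj₁ (at-injective s≤L a≤L sa , at-injective t≤L b≤L tb)
  at-SameEdge s≤L t≤L a≤L b≤L (inj₂ (sb , ta)) = inj₂ (at-injective s≤L b≤L sb , at-injective t≤L a≤L ta)

  cstep-suc : ∀ {t} → suc t ≤ L C → CStep C (position t) (position (suc t))
  cstep-suc {t} st≤L = inj₁ (≡.trans (toℕ-position st≤L) (cong suc (≡.sym (toℕ-position (ℕₚ.<⇒≤ st≤L)))))

  cstep-wrap : CStep C (position (L C)) (position 0)
  cstep-wrap = inj₂ (toℕ-position ℕₚ.≤-refl , toℕ-position z≤n)

  next : ∀ p → ∃ (CStep C p)
  next p with toℕ p ℕ.<? L C
  ... | yes p<L = position (suc (toℕ p)) , inj₁ (toℕ-position p<L)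
  ... | no p≮L  = position 0 , inj₂ (ℕₚ.≤-antisym (toℕ≤L p) (ℕₚ.≮⇒≥ p≮L) , toℕ-position z≤n)

  CStep⇒CEdge : ∀ {p p'} → CStep C p p' → CEdge C (vert C p) (vert C p')
  CStep⇒CEdge {p} {p'} s = p , p' , s , inj₁ (refl , refl)

  CEdge-sym : ∀ {u w} → CEdge C u w → CEdge C w u
  CEdge-sym (i , j , s , e) = i , j , s , SameEdge-swapʳ e

  CEdge⇒Adj : ∀ {u w} → CEdge C u w → Adj G u w
  CEdge⇒Adj (i , j , s , inj₁ (refl , refl)) = closed C i j s
  CEdge⇒Adj (i , j , s , inj₂ (refl , refl)) = adj-sym G (closed C i j s)

  CEdge-resp-SameEdge : ∀ {u w x y} → SameEdge u w x y → CEdge C u w → CEdge C x y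
  CEdge-resp-SameEdge (inj₁ (refl , refl)) e = e
  CEdge-resp-SameEdge (inj₂ (refl , refl)) e = CEdge-sym e

  ∉C⇒≉CStep : ∀ {u u' p p'} → CStep C p p' → ¬ CEdge C u u' → ¬ SameEdge u u' (vert C p) (vert C p')
  ∉C⇒≉CStep s u∉C same = u∉C (CEdge-resp-SameEdge (SameEdge-sym same) (CStep⇒CEdge s))

  CEdge-ends : ∀ {u u'} → CEdge C u u' → (∃ λ q → vert C q ≡ u) × (∃ λ q → vert C q ≡ u')
  CEdge-ends (i , j , _ , inj₁ (i≡u , j≡u')) = (i , i≡u) , (j , j≡u')
  CEdge-ends (i , j , _ , inj₂ (i≡u' , j≡u)) = (j , j≡u) , (i , i≡u')

  CEdgeExcept : Fin n → Fin n → Fin n → Fin n → Set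
  CEdgeExcept c d u w = CEdge C u w × ¬ SameEdge u w c d

  CEdgeExcept-sym : ∀ {c d u w} → CEdgeExcept c d u w → CEdgeExcept c d w u
  CEdgeExcept-sym (e , e≉cd) = CEdge-sym e , e≉cd ∘ SameEdge-swapˡ

  ascend : ∀ {R : Fin n → Fin n → Set} {lo hi} → lo ℕ.≤′ hi → hi ≤ L C →
           (∀ {t} → lo ≤ t → suc t ≤ hi → R (at t) (at (suc t))) → Star R (at lo) (at hi)
  ascend ℕ.≤′-refl        _    _    = ε
  ascend (ℕ.≤′-step lo≤h) h<L step =
    ascend lo≤h (ℕₚ.<⇒≤ h<L) (λ lo≤t t<h → step lo≤t (ℕₚ.m≤n⇒m≤1+n t<h)) ◅◅
    step (ℕₚ.≤′⇒≤ lo≤h) ℕₚ.≤-refl ◅ ε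

  module _ {a b} (a≤L : a ≤ L C) (b≤L : b ≤ L C) where

    private
      step : ∀ {t} → suc t ≤ L C → ¬ SameEdge t (suc t) a b → CEdgeExcept (at a) (at b) (at t) (at (suc t))
      step st≤L t≉ab = CStep⇒CEdge (cstep-suc st≤L) , t≉ab ∘ at-SameEdge (ℕₚ.<⇒≤ st≤L) st≤L a≤L b≤L

    descend-to-0 : ∀ {q} → q ≤ L C → (∀ {t} → suc t ≤ q → ¬ SameEdge t (suc t) a b) →
                   Star (CEdgeExcept (at a) (at b)) (at q) (at 0)
    descend-to-0 q≤L avoid = Star.reverse CEdgeExcept-sym
      (ascend (ℕₚ.≤⇒≤′ z≤n) q≤L λ _ t<q → step (ℕₚ.≤-trans t<q q≤L) (avoid t<q))

    ascend-and-wrap : ∀ {q} → q ≤ L C → (∀ {t} → q ≤ t → suc t ≤ L C → ¬ SameEdge t (suc t) a b) →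
                      ¬ SameEdge (L C) 0 a b → Star (CEdgeExcept (at a) (at b)) (at q) (at 0)
    ascend-and-wrap q≤L avoid wrap≉ab =
      ascend (ℕₚ.≤⇒≤′ q≤L) ℕₚ.≤-refl (λ q≤t t<L → step t<L (avoid q≤t t<L)) ◅◅
      (CStep⇒CEdge cstep-wrap , wrap≉ab ∘ at-SameEdge ℕₚ.≤-refl z≤n a≤L b≤L) ◅ ε

  ¬SameEdge-wrap : ∀ {t} → ¬ SameEdge t (suc t) (L C) 0
  ¬SameEdge-wrap (inj₁ (_ , ()))
  ¬SameEdge-wrap (inj₂ (refl , refl)) with L≥2 C
  ... | s≤s ()

  private
    -- Below the cut edge {a, b} descend to position 0; above it, ascend to L and wrap around.
    reach-0 : ∀ {a b q} → a ≤ L C → b ≤ L C → b ≡ suc a ⊎ (a ≡ L C × b ≡ 0) → q ≤ L C →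
              Star (CEdgeExcept (at a) (at b)) (at q) (at 0)
    reach-0 a≤L b≤L (inj₂ (refl , refl)) q≤L = descend-to-0 a≤L b≤L q≤L (λ _ → ¬SameEdge-wrap)
    reach-0 {a} {q = q} a≤L a<L (inj₁ refl) q≤L with q ℕ.≤? a
    ... | yes q≤a = descend-to-0 a≤L a<L q≤L λ t<q t≈a → ℕₚ.<-irrefl (SameEdge-suc t≈a) (ℕₚ.≤-trans t<q q≤a)
    ... | no q≰a  = ascend-and-wrap a≤L a<L q≤L
                      (λ q≤t _ t≈a → ℕₚ.<-irrefl (≡.sym (SameEdge-suc t≈a)) (ℕₚ.<-≤-trans (ℕₚ.≰⇒> q≰a) q≤t))
                      wrap≉
      where
      wrap≉ : ¬ SameEdge (L C) 0 a (suc a)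
      wrap≉ (inj₁ (L≡a , _))     = ℕₚ.<-irrefl (≡.sym L≡a) a<L
      wrap≉ (inj₂ (L≡sa , refl)) = ℕₚ.<-irrefl (≡.sym L≡sa) (L≥2 C)

  around : ∀ {p p'} → CStep C p p' → ∀ q r →
           Star (CEdgeExcept (vert C p) (vert C p')) (vert C q) (vert C r)
  around {p} {p'} s q r rewrite vert≡at p | vert≡at p' | vert≡at q | vert≡at r =
    reach-0 (toℕ≤L p) (toℕ≤L p') s (toℕ≤L q) ◅◅
    Star.reverse CEdgeExcept-sym (reach-0 (toℕ≤L p) (toℕ≤L p') s (toℕ≤L r))

only-cycle : ∀ {n} {G : Graph n} {κ} → IsComponentCount G κ → κ + numEdges G ≡ suc n →
             (C : Cycle G) → ∀ {p p' x y} → CStep C p p' →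
             Adj G x y → ¬ SameEdge x y (vert C p) (vert C p') →
             ¬ Star (λ u w → AdjExcept G (vert C p) (vert C p') u w × ¬ SameEdge u w x y) y x
only-cycle {G = G} cc h₁≡1 C {p} {p'} s xy xy≉ =
  no-second-cycle G cc h₁≡1 (closed C p p' s) xy xy≉
    (Star.map (λ (e , e≉) → CEdge⇒Adj e , e≉) (around s p' p))
  where open CycleWalks C

-- Sets of alive vertices

Alive : ℕ → Set
Alive k = Fin k → Bool

_⊆_ : ∀ {k} → Alive k → Alive k → Set
B ⊆ A = ∀ {i} → B i ≡ true → A i ≡ true

⊆-dead : ∀ {k} {A B : Alive k} {i} → B ⊆ A → A i ≡ false → B i ≡ false
⊆-dead {B = B} {i} B⊆A Ai≡false with B i in Bi
... | false = refl
... | true  = ≡.trans (≡.sym (B⊆A Bi)) Ai≡false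

∧-trueʳ : ∀ x {y} → x ∧ y ≡ true → y ≡ true
∧-trueʳ true e = e

delete : ∀ {k} → Fin k → Alive k → Alive k
delete a A i = not (does (a ≟ i)) ∧ A i

module _ {k} {a : Fin k} {A : Alive k} where

  delete-⊆ : delete a A ⊆ A
  delete-⊆ = ∧-trueʳ _

  delete-self : delete a A a ≡ false
  delete-self rewrite dec-true (a ≟ a) refl = refl

  delete-other : ∀ {i} → a ≢ i → delete a A i ≡ A i
  delete-other {i} a≢i rewrite dec-false (a ≟ i) a≢i = refl

  delete-false : ∀ {i} → delete a A i ≡ false → A i ≡ false ⊎ a ≡ i
  delete-false {i} e with a ≟ i
  ... | yes a≡i = inj₂ a≡i
  ... | no _    = inj₁ e

insert : ∀ {k} → Fin k → Alive k → Alive k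
insert y V i = V i ∨ does (y ≟ i)

module _ {k} {y : Fin k} {V : Alive k} where

  ⊆-insert : V ⊆ insert y V
  ⊆-insert Vi rewrite Vi = refl

  insert-self : insert y V y ≡ true
  insert-self rewrite dec-true (y ≟ y) refl = Boolₚ.∨-zeroʳ (V y)

  insert-cases : ∀ {i} → insert y V i ≡ true → V i ≡ true ⊎ i ≡ y
  insert-cases {i} e with V i | y ≟ i
  ... | true  | _        = inj₁ refl
  ... | false | yes refl = inj₂ refl

module _ {k} (G : Graph k) where

  deleteN : Fin k → Alive k → Alive k
  deleteN a A i = not (does (a ≟ i)) ∧ not (adj G a i) ∧ A i

  module _ {a : Fin k} {A : Alive k} where

    deleteN-⊆ : deleteN a A ⊆ A
    deleteN-⊆ {i} = ∧-trueʳ (not (adj G a i)) ∘ ∧-trueʳ (not (does (a ≟ i)))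

    deleteN-self : deleteN a A a ≡ false
    deleteN-self rewrite dec-true (a ≟ a) refl = refl

    deleteN-adj : ∀ {i} → Adj G a i → deleteN a A i ≡ false
    deleteN-adj {i} ai rewrite dec-false (a ≟ i) (adj⇒≢ G ai) | ai = refl

    deleteN-false : ∀ {i} → deleteN a A i ≡ false → A i ≡ false ⊎ a ≡ i ⊎ Adj G a i
    deleteN-false {i} e with a ≟ i | adj G a i
    ... | yes a≡i | _     = inj₂ (inj₁ a≡i)
    ... | no _    | true  = inj₂ (inj₂ refl)
    ... | no _    | false = inj₁ e

  IsolatedIn : Alive k → Fin k → Set
  IsolatedIn A a = ∀ z → Adj G a z → A z ≡ false

  LeafIn : Alive k → Fin k → Fin k → Set
  LeafIn A l p = A l ≡ true × A p ≡ true × Adj G p l × (∀ z → Adj G l z → z ≢ p → A z ≡ false)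

  isolated⇒deleteN≗delete : ∀ {A a} → IsolatedIn A a → ∀ i → deleteN a A i ≡ delete a A i
  isolated⇒deleteN≗delete {A} {a} iso i with a ≟ i | adj G a i in ai
  ... | yes _ | _     = refl
  ... | no _  | false = refl
  ... | no _  | true  = ≡.sym (iso i ai)

-- Monomial ideals of partially resolved graphs

module _ {n : ℕ} where

  ≐-sym : {I J : MonIdeal n} → I ≐ J → J ≐ I
  ≐-sym I≐J m = proj₂ (I≐J m) , proj₁ (I≐J m)

  ≐-trans : {I J K : MonIdeal n} → I ≐ J → J ≐ K → I ≐ K
  ≐-trans I≐J J≐K m = proj₁ (J≐K m) ∘ proj₁ (I≐J m) , proj₂ (I≐J m) ∘ proj₂ (J≐K m)

  ∶-resp-≐ : {I J : MonIdeal n} → I ≐ J → ∀ a → (I ∶ a) ≐ (J ∶ a)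
  ∶-resp-≐ I≐J a m = I≐J (m *x a)

  ,,-resp-≐ : {I J : MonIdeal n} → I ≐ J → ∀ a → (I ,, a) ≐ (J ,, a)
  ,,-resp-≐ I≐J a m = map₂ (proj₁ (I≐J m)) , map₂ (proj₂ (I≐J m))

  IsCone-resp-≐ : {I J : MonIdeal n} → I ≐ J → ∀ {a} → IsCone I a → IsCone J a
  IsCone-resp-≐ I≐J {a} cone = ≐-trans (≐-trans (∶-resp-≐ (≐-sym I≐J) a) cone) (,,-resp-≐ I≐J a)

  Step-resp-≐ : {I J : MonIdeal n} → I ≐ J → ∀ {a} → Step I a → Step J a
  Step-resp-≐ I≐J (a∉I , inj₁ cone) = a∉I ∘ proj₂ (I≐J _) , inj₁ (IsCone-resp-≐ I≐J cone)
  Step-resp-≐ I≐J {a} (a∉I , inj₂ (b , ¬cone , cone)) =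
    a∉I ∘ proj₂ (I≐J _) ,
    inj₂ (b , ¬cone ∘ IsCone-resp-≐ (≐-sym I≐J) , IsCone-resp-≐ (,,-resp-≐ I≐J a) cone)

  SphStep-resp-≐ : {I J : MonIdeal n} → I ≐ J → ∀ {a} → SphStep I a → SphStep J a
  SphStep-resp-≐ I≐J (step , ¬cone) = Step-resp-≐ I≐J step , ¬cone ∘ IsCone-resp-≐ (≐-sym I≐J)

module _ {n : ℕ} (m : Mon n) (a : Fin n) where

  *x-self : (m *x a) a ≡ suc (m a)
  *x-self with a ≟ a
  ... | yes _   = refl
  ... | no a≢a  = ⊥-elim (a≢a refl)

  *x-other : ∀ {b} → a ≢ b → (m *x a) b ≡ m b
  *x-other {b} a≢b with a ≟ b
  ... | yes a≡b = ⊥-elim (a≢b a≡b)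
  ... | no _    = refl

  ≤-*x : ∀ b → m b ≤ (m *x a) b
  ≤-*x b with a ≟ b
  ... | yes _ = ℕₚ.n≤1+n (m b)
  ... | no _  = ℕₚ.≤-refl

  1≤*x : 1 ≤ (m *x a) a
  1≤*x rewrite *x-self = s≤s z≤n

module _ {n : ℕ} {a i : Fin n} where

  var≤1 : var a i ≤ 1
  var≤1 with a ≟ i
  ... | yes _ = s≤s z≤n
  ... | no _  = z≤n

  1≤var⇒≡ : 1 ≤ var a i → a ≡ i
  1≤var⇒≡ _  with a ≟ i
  1≤var⇒≡ _  | yes a≡i = a≡i
  1≤var⇒≡ () | no _

module EdgeIdealOn {n : ℕ} (G : Graph n) where

  -- The edge ideal of G with the variables of the vertices outside A adjoined;
  -- this family is closed under the colon and sum operations of a resolution.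
  ℐ : Alive n → MonIdeal n
  ℐ A m = (∃ λ i → 2 ≤ m i) ⊎ (∃ λ i → A i ≡ false × 1 ≤ m i) ⊎ (∃₂ λ i j → Adj G i j × 1 ≤ m i × 1 ≤ m j)

  edgeIdeal≐ℐ : edgeIdeal G ≐ ℐ (λ _ → true)
  edgeIdeal≐ℐ m =
    map₂ inj₂ , λ { (inj₁ sq) → inj₁ sq ; (inj₂ (inj₁ (_ , () , _))) ; (inj₂ (inj₂ e)) → inj₂ e }

  ℐ-dead≐maxIdeal : ∀ {A} → (∀ i → A i ≡ false) → ℐ A ≐ maxIdeal
  ℐ-dead≐maxIdeal dead m = to , λ (i , 1≤mi) → inj₂ (inj₁ (i , dead i , 1≤mi))
    where
    to : ℐ _ m → maxIdeal m
    to (inj₁ (i , 2≤mi))                    = i , ℕₚ.≤-trans (s≤s z≤n) 2≤mi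
    to (inj₂ (inj₁ (i , _ , 1≤mi)))         = i , 1≤mi
    to (inj₂ (inj₂ (i , _ , _ , 1≤mi , _))) = i , 1≤mi

  ℐ-antitone : ∀ {A B} → B ⊆ A → ∀ {m} → ℐ A m → ℐ B m
  ℐ-antitone _ (inj₁ sq)         = inj₁ sq
  ℐ-antitone _ (inj₂ (inj₂ e))   = inj₂ (inj₂ e)
  ℐ-antitone {A} {B} B⊆A (inj₂ (inj₁ (i , dead , 1≤mi))) =
    inj₂ (inj₁ (i , ⊆-dead {A = A} {B} B⊆A dead , 1≤mi))

  ℐ-cong : ∀ {A B} → (∀ i → A i ≡ B i) → ℐ A ≐ ℐ B
  ℐ-cong {A} {B} A≗B m =
    ℐ-antitone {A} {B} (λ {i} → ≡.trans (A≗B i)) , ℐ-antitone {B} {A} (λ {i} → ≡.trans (≡.sym (A≗B i)))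

  dead⇒var∈ℐ : ∀ {A a} → A a ≡ false → ℐ A ∋x a
  dead⇒var∈ℐ {a = a} dead = inj₂ (inj₁ (a , dead , 1≤*x _ a))

  var∈ℐ⇒dead : ∀ {A a} → ℐ A ∋x a → A a ≡ false
  var∈ℐ⇒dead {a = a} (inj₁ (i , 2≤var)) with ℕₚ.≤-trans 2≤var (var≤1 {a = a} {i})
  ... | s≤s ()
  var∈ℐ⇒dead {a = a} (inj₂ (inj₁ (i , dead , 1≤var))) with 1≤var⇒≡ {a = a} {i} 1≤var
  ... | refl = dead
  var∈ℐ⇒dead {a = a} (inj₂ (inj₂ (i , j , ij , 1≤vi , 1≤vj)))
    with 1≤var⇒≡ {a = a} {i} 1≤vi | 1≤var⇒≡ {a = a} {j} 1≤vj
  ... | refl | refl = ⊥-elim (adj⇒≢ G ij refl)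

  var∉ℐ⇒alive : ∀ {A a} → ¬ ℐ A ∋x a → A a ≡ true
  var∉ℐ⇒alive {A} {a} a∉ with A a in Aa
  ... | true  = refl
  ... | false = ⊥-elim (a∉ (dead⇒var∈ℐ Aa))

  1∉ℐ : ∀ {A} → ¬ ℐ A (λ _ → 0)
  1∉ℐ (inj₁ (_ , ()))
  1∉ℐ (inj₂ (inj₁ (_ , _ , ())))
  1∉ℐ (inj₂ (inj₂ (_ , _ , _ , () , _)))

  ℐ-∶ : ∀ {A a} → A a ≡ true → (ℐ A ∶ a) ≐ ℐ (deleteN G a A)
  ℐ-∶ {A} {a} alive m = to , from
    where
    bump : ∀ {i} → a ≢ i → ∀ {k} → k ≤ (m *x a) i → k ≤ m i
    bump a≢i = subst (_ ≤_) (*x-other m a a≢i)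
    to : ℐ A (m *x a) → ℐ (deleteN G a A) m
    to (inj₁ (i , 2≤)) with toSum (a ≟ i)
    ... | inj₁ refl = inj₂ (inj₁ (a , deleteN-self G {a} {A} , ℕₚ.≤-pred (subst (2 ≤_) (*x-self m a) 2≤)))
    ... | inj₂ a≢i  = inj₁ (i , bump a≢i 2≤)
    to (inj₂ (inj₁ (i , dead , 1≤))) with toSum (a ≟ i)
    ... | inj₁ refl = ⊥-elim (not-¬ alive dead)
    ... | inj₂ a≢i  = inj₂ (inj₁ (i , ⊆-dead {A = A} (deleteN-⊆ G {a} {A}) dead , bump a≢i 1≤))
    to (inj₂ (inj₂ (i , j , ij , 1≤i , 1≤j))) with toSum (a ≟ i) | toSum (a ≟ j)
    ... | inj₁ refl | inj₁ refl = ⊥-elim (adj⇒≢ G ij refl)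
    ... | inj₁ refl | inj₂ a≢j  = inj₂ (inj₁ (j , deleteN-adj G {a} {A} ij , bump a≢j 1≤j))
    ... | inj₂ a≢i  | inj₁ refl = inj₂ (inj₁ (i , deleteN-adj G {a} {A} (adj-sym G ij) , bump a≢i 1≤i))
    ... | inj₂ a≢i  | inj₂ a≢j  = inj₂ (inj₂ (i , j , ij , bump a≢i 1≤i , bump a≢j 1≤j))
    from : ℐ (deleteN G a A) m → ℐ A (m *x a)
    from (inj₁ (i , 2≤)) = inj₁ (i , ℕₚ.≤-trans 2≤ (≤-*x m a i))
    from (inj₂ (inj₁ (i , dead , 1≤))) with deleteN-false G {a} {A} {i} dead
    ... | inj₁ deadA       = inj₂ (inj₁ (i , deadA , ℕₚ.≤-trans 1≤ (≤-*x m a i)))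
    ... | inj₂ (inj₁ refl) = inj₁ (a , subst (2 ≤_) (≡.sym (*x-self m a)) (s≤s 1≤))
    ... | inj₂ (inj₂ ai)   = inj₂ (inj₂ (a , i , ai , 1≤*x m a , ℕₚ.≤-trans 1≤ (≤-*x m a i)))
    from (inj₂ (inj₂ (i , j , ij , 1≤i , 1≤j))) =
      inj₂ (inj₂ (i , j , ij , ℕₚ.≤-trans 1≤i (≤-*x m a i) , ℕₚ.≤-trans 1≤j (≤-*x m a j)))

  ℐ-,, : ∀ {A a} → (ℐ A ,, a) ≐ ℐ (delete a A)
  ℐ-,, {A} {a} m = to , from
    where
    to : (ℐ A ,, a) m → ℐ (delete a A) m
    to (inj₁ 1≤) = inj₂ (inj₁ (a , delete-self {a = a} {A} , 1≤))
    to (inj₂ m∈) = ℐ-antitone (delete-⊆ {a = a} {A}) m∈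
    from : ℐ (delete a A) m → (ℐ A ,, a) m
    from (inj₂ (inj₁ (i , dead , 1≤))) with delete-false {a = a} {A} {i} dead
    ... | inj₁ deadA = inj₂ (inj₂ (inj₁ (i , deadA , 1≤)))
    ... | inj₂ refl  = inj₁ 1≤
    from (inj₁ sq)       = inj₂ (inj₁ sq)
    from (inj₂ (inj₂ e)) = inj₂ (inj₂ (inj₂ e))

  isolated⇒IsCone : ∀ {A a} → A a ≡ true → IsolatedIn G A a → IsCone (ℐ A) a
  isolated⇒IsCone {A} {a} alive iso =
    ≐-trans (ℐ-∶ alive) (≐-trans (ℐ-cong (isolated⇒deleteN≗delete G iso)) (≐-sym (ℐ-,, {A} {a})))

  IsCone⇒isolated : ∀ {A b} → IsCone (ℐ A) b → A b ≡ true × IsolatedIn G A b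
  IsCone⇒isolated {A} {b} cone = alive , isolated
    where
    alive : A b ≡ true
    alive with A b in Ab
    ... | true  = refl
    ... | false with proj₁ (cone (λ _ → 0)) (dead⇒var∈ℐ Ab)
    ...   | inj₁ ()
    ...   | inj₂ 1∈ = ⊥-elim (1∉ℐ 1∈)
    isolated : IsolatedIn G A b
    isolated x bx with A x in Ax | proj₁ (cone (var x)) (inj₂ (inj₂ (b , x , bx , 1≤*x (var x) b ,
                                      subst (1 ≤_) (≡.sym (*x-other (var x) b (adj⇒≢ G bx))) (1≤*x _ x))))
    ... | false | _        = refl
    ... | true  | inj₁ 1≤  = ⊥-elim (adj⇒≢ G bx (≡.sym (1≤var⇒≡ {a = x} {b} 1≤)))
    ... | true  | inj₂ x∈  = ≡.trans (≡.sym Ax) (var∈ℐ⇒dead x∈)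

  isolated⇒Step : ∀ {A a} → A a ≡ true → IsolatedIn G A a → Step (ℐ A) a
  isolated⇒Step alive iso = not-¬ alive ∘ var∈ℐ⇒dead , inj₁ (isolated⇒IsCone alive iso)

  leaf⇒Step : ∀ {A l p} → LeafIn G A l p → Step (ℐ A) p
  leaf⇒Step {A} {l} {p} (alive-l , alive-p , pl , others-dead) =
    not-¬ alive-p ∘ var∈ℐ⇒dead , inj₂ (l , ¬cone , cone)
    where
    ¬cone : ¬ IsCone (ℐ A) l
    ¬cone c = not-¬ alive-p (proj₂ (IsCone⇒isolated c) p (adj-sym G pl))
    isolated : IsolatedIn G (delete p A) l
    isolated z lz with toSum (p ≟ z)
    ... | inj₁ refl = delete-self {a = p} {A}
    ... | inj₂ p≢z  = ⊆-dead {A = A} (delete-⊆ {a = p} {A}) (others-dead z lz (p≢z ∘ ≡.sym))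
    cone : IsCone (ℐ A ,, p) l
    cone = IsCone-resp-≐ (≐-sym (ℐ-,, {A} {p}))
             (isolated⇒IsCone (≡.trans (delete-other {a = p} {A} (adj⇒≢ G pl)) alive-l) isolated)

  SphStep⇒leaf : ∀ {A a} → SphStep (ℐ A) a → ∃ λ l → LeafIn G A l a
  SphStep⇒leaf ((_ , inj₁ cone) , ¬cone) = ⊥-elim (¬cone cone)
  SphStep⇒leaf {A} {a} ((a∉ , inj₂ (b , ¬cone , cone)) , _) =
    b , delete-⊆ {a = a} {A} alive-b , var∉ℐ⇒alive a∉ , ab , others-dead
    where
    b-in-A-a : delete a A b ≡ true × IsolatedIn G (delete a A) b
    b-in-A-a = IsCone⇒isolated (IsCone-resp-≐ (ℐ-,, {A} {a}) cone)
    alive-b = proj₁ b-in-A-a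
    others-dead : ∀ z → Adj G b z → z ≢ a → A z ≡ false
    others-dead z bz z≢a with delete-false {a = a} {A} {z} (proj₂ b-in-A-a z bz)
    ... | inj₁ dead = dead
    ... | inj₂ a≡z  = ⊥-elim (z≢a (≡.sym a≡z))
    ab : Adj G a b
    ab with adj G b a in ba
    ... | true  = adj-sym G ba
    ... | false = ⊥-elim (¬cone (isolated⇒IsCone (delete-⊆ {a = a} {A} alive-b) isolated))
      where
      isolated : IsolatedIn G A b
      isolated z bz with toSum (z ≟ a)
      ... | inj₁ refl = ⊥-elim (not-¬ bz ba)
      ... | inj₂ z≢a  = others-dead z bz z≢a

-- The independence polynomial at -1

tail : ∀ {k} → Graph (suc k) → Graph k
tail G = record
  { adj    = λ i j → adj G (Fin.suc i) (Fin.suc j)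
  ; sym    = λ i j → Graph.sym G (Fin.suc i) (Fin.suc j)
  ; irrefl = λ i → irrefl G (Fin.suc i)
  }

infix 7 [_]·_
[_]·_ : Bool → ℤ → ℤ
[ b ]· z = if b then z else 0ℤ

-- χ G A = Σ (-1)^|S| over the independent sets S ⊆ A of G, i.e. the independence
-- polynomial of the subgraph induced on A evaluated at -1 (recursion on vertex 0).
χ : ∀ {k} → Graph k → Alive k → ℤ
χ {zero}  G A = 1ℤ
χ {suc k} G A = χ (tail G) (A ∘ Fin.suc) - [ A Fin.zero ]· χ (tail G) (deleteN G Fin.zero A ∘ Fin.suc)

χ-cong : ∀ {k} (G : Graph k) {A B} → (∀ i → A i ≡ B i) → χ G A ≡ χ G B
χ-cong {zero}  G A≗B = refl
χ-cong {suc k} G {A} {B} A≗B rewrite A≗B Fin.zero =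
  cong₂ (λ u w → u - [ B Fin.zero ]· w) (χ-cong (tail G) (A≗B ∘ Fin.suc))
    (χ-cong (tail G) λ i → cong (not (adj G Fin.zero (Fin.suc i)) ∧_) (A≗B (Fin.suc i)))

private
  ∧-swap : ∀ a b c → a ∧ b ∧ c ≡ b ∧ a ∧ c
  ∧-swap a b c =
    ≡.trans (≡.sym (Boolₚ.∧-assoc a b c)) (≡.trans (cong (_∧ c) (Boolₚ.∧-comm a b)) (Boolₚ.∧-assoc b a c))

  exchange : ∀ (P Q R S : ℤ) → (P - Q) - (R - S) ≡ (P - R) - (Q - S)
  exchange = solve-∀

  -- Splitting at vertex 0 and at x commute (r: whether 0 and x are adjacent). Each case
  -- is an instance of exchange because 0ℤ - 0ℤ reduces to 0ℤ.
  interchange : ∀ p q r (P Q R S : ℤ) →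
                (P - [ q ]· Q) - [ p ]· (R - [ not r ∧ q ]· S) ≡
                (P - [ p ]· R) - [ q ]· (Q - [ not r ∧ p ]· S)
  interchange false false _     P Q R S = refl
  interchange false true  true  P Q R S = exchange P Q 0ℤ 0ℤ
  interchange false true  false P Q R S = exchange P Q 0ℤ 0ℤ
  interchange true  false true  P Q R S = exchange P 0ℤ R 0ℤ
  interchange true  false false P Q R S = exchange P 0ℤ R 0ℤ
  interchange true  true  true  P Q R S = exchange P Q R 0ℤ
  interchange true  true  false P Q R S = exchange P Q R S

χ-split : ∀ {k} (G : Graph k) A x → χ G A ≡ χ G (delete x A) - [ A x ]· χ G (deleteN G x A)
χ-split {suc k} G A Fin.zero =
  cong₂ (λ u w → u - [ A Fin.zero ]· w) (≡.sym (ℤₚ.+-identityʳ (χ (tail G) (A ∘ Fin.suc))))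
    (≡.sym (ℤₚ.+-identityʳ (χ (tail G) (deleteN G Fin.zero A ∘ Fin.suc))))
χ-split {suc k} G A x@(Fin.suc y) = begin
  χ G′ B - [ p ]· χ G′ B₀
    ≡⟨ cong₂ (λ u w → u - [ p ]· w) (χ-split G′ B y) (χ-split G′ B₀ y) ⟩
  (P - [ q ]· Q) - [ p ]· (R - [ not (adj G Fin.zero x) ∧ q ]· S)
    ≡⟨ interchange p q (adj G Fin.zero x) P Q R S ⟩
  (P - [ p ]· R) - [ q ]· (Q - [ not (adj G Fin.zero x) ∧ p ]· S)
    ≡⟨ cong₂ (λ u w → (P - [ p ]· u) - [ q ]· (Q - w)) R≡ S≡ ⟩
  χ G (delete x A) - [ q ]· χ G (deleteN G x A)
    ∎
  where
  open ≡.≡-Reasoning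
  G′ = tail G
  B B₀ : Alive k
  B  = A ∘ Fin.suc
  B₀ = deleteN G Fin.zero A ∘ Fin.suc
  p q : Bool
  p = A Fin.zero
  q = A x
  P Q R S : ℤ
  P = χ G′ (delete y B)
  Q = χ G′ (deleteN G′ y B)
  R = χ G′ (delete y B₀)
  S = χ G′ (deleteN G′ y B₀)
  R≡ : R ≡ χ G′ (deleteN G Fin.zero (delete x A) ∘ Fin.suc)
  R≡ = χ-cong G′ λ i → ∧-swap (not (does (y ≟ i))) (not (adj G Fin.zero (Fin.suc i))) (B i)
  S≡ : [ not (adj G Fin.zero x) ∧ p ]· S ≡
       [ not (adj G x Fin.zero) ∧ p ]· χ G′ (deleteN G Fin.zero (deleteN G x A) ∘ Fin.suc)
  S≡ = cong₂ (λ r u → [ not r ∧ p ]· u) (Graph.sym G Fin.zero x) (χ-cong G′ λ i →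
         let a = not (does (y ≟ i)); b = not (adj G x (Fin.suc i)); c = not (adj G Fin.zero (Fin.suc i)) in
         ≡.trans (cong (a ∧_) (∧-swap b c (B i))) (∧-swap a c (b ∧ B i)))

χ-dead : ∀ {k} (G : Graph k) {A} → (∀ i → A i ≡ false) → χ G A ≡ 1ℤ
χ-dead {zero}  G dead = refl
χ-dead {suc k} G dead rewrite dead Fin.zero =
  ≡.trans (ℤₚ.+-identityʳ _) (χ-dead (tail G) (dead ∘ Fin.suc))

module _ {k} (G : Graph k) where

  χ-isolated : ∀ {A x} → A x ≡ true → IsolatedIn G A x → χ G A ≡ 0ℤ
  χ-isolated {A} {x} alive iso = begin
    χ G A
      ≡⟨ χ-split G A x ⟩
    χ G (delete x A) - [ A x ]· χ G (deleteN G x A)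
      ≡⟨ cong₂ (λ b u → χ G (delete x A) - [ b ]· u) alive (χ-cong G (isolated⇒deleteN≗delete G iso)) ⟩
    χ G (delete x A) - χ G (delete x A)
      ≡⟨ ℤₚ.+-inverseʳ (χ G (delete x A)) ⟩
    0ℤ
      ∎
    where open ≡.≡-Reasoning

  -- Split at l, then at p: as A ∖ N[l] = A ∖ {l, p}, the two χ (A ∖ {l, p}) terms cancel.
  χ-leaf : ∀ {A l p} → LeafIn G A l p → χ G A ≡ - χ G (deleteN G p A)
  χ-leaf {A} {l} {p} (alive-l , alive-p , pl , others-dead) = begin
    χ G A
      ≡⟨ χ-split G A l ⟩
    χ G (delete l A) - [ A l ]· χ G (deleteN G l A)
      ≡⟨ cong₂ (λ b u → χ G (delete l A) - [ b ]· u) alive-l (χ-cong G N[l]≗) ⟩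
    χ G (delete l A) - X
      ≡⟨ cong (_- X) (χ-split G (delete l A) p) ⟩
    (X - [ delete l A p ]· χ G (deleteN G p (delete l A))) - X
      ≡⟨ cong₂ (λ b u → (X - [ b ]· u) - X) alive-p′ (χ-cong G N[p]≗) ⟩
    (X - Y) - X
      ≡⟨ cancel X Y ⟩
    - Y
      ∎
    where
    open ≡.≡-Reasoning
    X Y : ℤ
    X = χ G (delete p (delete l A))
    Y = χ G (deleteN G p A)
    cancel : ∀ (X Y : ℤ) → (X - Y) - X ≡ - Y
    cancel = solve-∀
    alive-p′ : delete l A p ≡ true
    alive-p′ = ≡.trans (delete-other {a = l} {A} (adj⇒≢ G (adj-sym G pl))) alive-p
    N[l]≗ : ∀ i → deleteN G l A i ≡ delete p (delete l A) i
    N[l]≗ i with l ≟ i | p ≟ i | adj G l i in li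
    ... | yes _ | yes _    | _     = refl
    ... | yes _ | no _     | _     = refl
    ... | no _  | yes _    | true  = refl
    ... | no _  | yes refl | false = ⊥-elim (not-¬ (adj-sym G pl) li)
    ... | no _  | no p≢i   | true  = ≡.sym (others-dead i li (p≢i ∘ ≡.sym))
    ... | no _  | no _     | false = refl
    N[p]≗ : ∀ i → deleteN G p (delete l A) i ≡ deleteN G p A i
    N[p]≗ i with p ≟ i | adj G p i in pi | l ≟ i
    ... | yes _ | _     | _        = refl
    ... | no _  | true  | _        = refl
    ... | no _  | false | yes refl = ⊥-elim (not-¬ pl pi)
    ... | no _  | false | no _     = refl

-- Leaves of acyclic graphs

count : ∀ {k} → Alive k → ℕ
count {zero}  A = 0
count {suc k} A = (if A Fin.zero then 1 else 0) + count (A ∘ Fin.suc)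

count-mono : ∀ {k} {A B : Alive k} → B ⊆ A → count B ≤ count A
count-mono {zero}          B⊆A = z≤n
count-mono {suc k} {A} {B} B⊆A with B Fin.zero in B0 | A Fin.zero in A0
... | true  | true  = s≤s (count-mono {A = A ∘ Fin.suc} {B ∘ Fin.suc} B⊆A)
... | true  | false = ⊥-elim (not-¬ (B⊆A B0) A0)
... | false | true  = ℕₚ.m≤n⇒m≤1+n (count-mono {A = A ∘ Fin.suc} {B ∘ Fin.suc} B⊆A)
... | false | false = count-mono {A = A ∘ Fin.suc} {B ∘ Fin.suc} B⊆A

count-strict : ∀ {k} {A B : Alive k} {y} → B ⊆ A → A y ≡ true → B y ≡ false → count B < count A
count-strict {suc k} {A} {B} {Fin.zero} B⊆A Ay By rewrite Ay | By =
  s≤s (count-mono {A = A ∘ Fin.suc} {B ∘ Fin.suc} B⊆A)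
count-strict {suc k} {A} {B} {Fin.suc y} B⊆A Ay By with B Fin.zero in B0 | A Fin.zero in A0
... | true  | true  = s≤s (count-strict {A = A ∘ Fin.suc} {B ∘ Fin.suc} B⊆A Ay By)
... | true  | false = ⊥-elim (not-¬ (B⊆A B0) A0)
... | false | true  = ℕₚ.m≤n⇒m≤1+n (count-strict {A = A ∘ Fin.suc} {B ∘ Fin.suc} B⊆A Ay By)
... | false | false = count-strict {A = A ∘ Fin.suc} {B ∘ Fin.suc} B⊆A Ay By

count-deleteN : ∀ {k} (G : Graph k) {A a} → A a ≡ true → count (deleteN G a A) < count A
count-deleteN G {A} {a} alive =
  count-strict {A = A} {deleteN G a A} (deleteN-⊆ G {a} {A}) alive (deleteN-self G {a} {A})

module _ {k} (G : Graph k) where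

  StepAvoiding : Alive k → Fin k → Fin k → Fin k → Fin k → Set
  StepAvoiding A x y p q = Adj G p q × A p ≡ true × A q ≡ true × ¬ SameEdge p q x y

  AcyclicOn : Alive k → Set
  AcyclicOn A = ∀ {x y} → Adj G x y → A x ≡ true → A y ≡ true → ¬ Star (StepAvoiding A x y) y x

  AcyclicOn-antitone : ∀ {A B} → B ⊆ A → AcyclicOn A → AcyclicOn B
  AcyclicOn-antitone B⊆A acyclic xy Bx By cycle =
    acyclic xy (B⊆A Bx) (B⊆A By) (Star.map (λ (pq , Bp , Bq , pq≉) → pq , B⊆A Bp , B⊆A Bq , pq≉) cycle)

  module _ {A : Alive k} (acyclic : AcyclicOn A) {s : Fin k} where

    private
      -- A path s, …, prev, cur through the visited set V; any visited z reaches cur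
      -- inside V without using the edge {z, cur}.
      record Trail (V : Alive k) (cur prev : Fin k) : Set where
        field
          s∈V      : V s ≡ true
          cur∈V    : V cur ≡ true
          prev∈V   : V prev ≡ true
          prev~cur : Adj G prev cur
          cur≢s    : cur ≢ s
          V⊆A      : V ⊆ A
          back     : ∀ {z} → V z ≡ true → z ≢ cur → z ≢ prev → Star (StepAvoiding V z cur) z cur

      extend : ∀ {V cur prev y} → Trail V cur prev → Adj G cur y → A y ≡ true → V y ≡ false →
               Trail (insert y V) y cur
      extend {V} {cur} {prev} {y} t cy Ay Vy = record
        { s∈V = grow s∈V ; cur∈V = y∈V′ ; prev∈V = grow cur∈V ; prev~cur = cy
        ; cur≢s = ≢y s∈V ∘ ≡.sym ; V⊆A = V′⊆A ; back = back′ }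
        where
        open Trail t
        grow : V ⊆ insert y V
        grow = ⊆-insert {y = y} {V}
        y∈V′ : insert y V y ≡ true
        y∈V′ = insert-self {y = y} {V}
        ≢y : ∀ {i} → V i ≡ true → i ≢ y
        ≢y Vi refl = not-¬ Vi Vy
        V′⊆A : insert y V ⊆ A
        V′⊆A V′i with insert-cases {y = y} {V} V′i
        ... | inj₁ Vi   = V⊆A Vi
        ... | inj₂ refl = Ay
        widen : ∀ {z p q} → StepAvoiding V z cur p q → StepAvoiding (insert y V) z y p q
        widen (pq , Vp , Vq , _) = pq , grow Vp , grow Vq ,
          λ { (inj₁ (_ , q≡y)) → ≢y Vq q≡y ; (inj₂ (p≡y , _)) → ≢y Vp p≡y }
        last : ∀ {z} → z ≢ cur → StepAvoiding (insert y V) z y cur y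
        last z≢cur = cy , grow cur∈V , y∈V′ ,
          λ { (inj₁ (cur≡z , _)) → z≢cur (≡.sym cur≡z) ; (inj₂ (cur≡y , _)) → ≢y cur∈V cur≡y }
        back′ : ∀ {z} → insert y V z ≡ true → z ≢ y → z ≢ cur → Star (StepAvoiding (insert y V) z y) z y
        back′ {z} V′z z≢y z≢cur with insert-cases {y = y} {V} V′z
        ... | inj₂ z≡y = ⊥-elim (z≢y z≡y)
        ... | inj₁ Vz with toSum (z ≟ prev)
        ...   | inj₂ z≢prev = Star.map widen (back Vz z≢cur z≢prev) ◅◅ last z≢cur ◅ ε
        ...   | inj₁ refl   = (prev~cur , grow prev∈V , grow cur∈V , prev-cur≉) ◅ last z≢cur ◅ ε
          where
          prev-cur≉ : ¬ SameEdge prev cur prev y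
          prev-cur≉ (inj₁ (_ , cur≡y))  = ≢y cur∈V cur≡y
          prev-cur≉ (inj₂ (prev≡y , _)) = ≢y prev∈V prev≡y

      otherAliveNeighbour? : ∀ cur prev → Dec (∃ λ y → Adj G cur y × A y ≡ true × y ≢ prev)
      otherAliveNeighbour? cur prev =
        Finₚ.any? λ y → (adj G cur y Boolₚ.≟ true) ×-dec (A y Boolₚ.≟ true) ×-dec ¬? (y ≟ prev)

      -- Extend the trail until cur has no alive neighbour besides prev; revisiting a
      -- vertex would close a cycle.
      walk : ∀ {V cur prev} → Acc _<_ (count (not ∘ V)) → Trail V cur prev →
             ∃₂ λ l p → l ≢ s × LeafIn G A l p
      walk {V} {cur} {prev} (acc rec) t with otherAliveNeighbour? cur prev
      ... | no none = cur , prev , cur≢s , V⊆A cur∈V , V⊆A prev∈V , prev~cur , cur-leaf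
        where
        open Trail t
        cur-leaf : ∀ z → Adj G cur z → z ≢ prev → A z ≡ false
        cur-leaf z cz z≢prev with A z in Az
        ... | false = refl
        ... | true  = ⊥-elim (none (z , cz , Az , z≢prev))
      ... | yes (y , cy , Ay , y≢prev) with V y in Vy
      ...   | true  =
        ⊥-elim (acyclic cy (V⊆A cur∈V) Ay (Star.map widen (back Vy (adj⇒≢ G cy ∘ ≡.sym) y≢prev)))
        where
        open Trail t
        widen : ∀ {p q} → StepAvoiding V y cur p q → StepAvoiding A cur y p q
        widen (pq , Vp , Vq , pq≉) = pq , V⊆A Vp , V⊆A Vq , pq≉ ∘ SameEdge-swapʳ
      ...   | false = walk (rec fewer-unvisited) (extend t cy Ay Vy)
        where
        unvisited-shrinks : (not ∘ insert y V) ⊆ (not ∘ V)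
        unvisited-shrinks {i} e with V i
        ... | false = refl
        fewer-unvisited : count (not ∘ insert y V) < count (not ∘ V)
        fewer-unvisited = count-strict {A = not ∘ V} {not ∘ insert y V} unvisited-shrinks
                            (cong not Vy) (cong not (insert-self {y = y} {V}))

    leaf-or-isolated : A s ≡ true → IsolatedIn G A s ⊎ ∃₂ λ l p → l ≢ s × LeafIn G A l p
    leaf-or-isolated As with Finₚ.any? (λ y → (adj G s y Boolₚ.≟ true) ×-dec (A y Boolₚ.≟ true))
    ... | no none = inj₁ isolated
      where
      isolated : IsolatedIn G A s
      isolated z sz with A z in Az
      ... | false = refl
      ... | true  = ⊥-elim (none (z , sz , Az))
    ... | yes (x , sx , Ax) = inj₂ (walk (<-wellFounded _) record
      { s∈V = s∈V₀ ; cur∈V = insert-self {y = x} {Vₛ} ; prev∈V = s∈V₀ ; prev~cur = sx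
      ; cur≢s = adj⇒≢ G sx ∘ ≡.sym ; V⊆A = V₀⊆A
      ; back = λ V₀z z≢x z≢s → ⊥-elim ([ z≢s , z≢x ]′ (V₀-cases V₀z)) })
      where
      Vₛ V₀ : Alive k
      Vₛ = insert s (λ _ → false)
      V₀ = insert x Vₛ
      s∈V₀ : V₀ s ≡ true
      s∈V₀ = ⊆-insert {y = x} {Vₛ} (insert-self {y = s} {λ _ → false})
      V₀-cases : ∀ {i} → V₀ i ≡ true → i ≡ s ⊎ i ≡ x
      V₀-cases V₀i with insert-cases {y = x} {Vₛ} V₀i
      ... | inj₂ i≡x = inj₂ i≡x
      ... | inj₁ Vi with insert-cases {y = s} {λ _ → false} Vi
      ...   | inj₂ i≡s = inj₁ i≡s
      V₀⊆A : V₀ ⊆ A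
      V₀⊆A V₀i with V₀-cases V₀i
      ... | inj₁ refl = As
      ... | inj₂ refl = Ax

-- Resolutions

Simple-∷ : ∀ {n} {J : MonIdeal n} {a} → Step J a → Simple (J ∶ a) → Simple J
Simple-∷ step (as , res , maximal , core≐) = _ ∷ as , (step , res) , maximal , core≐

dead⊎alive : ∀ {n} (A : Alive n) → (∀ i → A i ≡ false) ⊎ ∃ λ s → A s ≡ true
dead⊎alive A with Finₚ.any? (λ i → A i Boolₚ.≟ true)
... | yes alive = inj₂ alive
... | no none   = inj₁ λ i → Boolₚ.¬-not (λ Ai → none (i , Ai))

module _ {n} (G : Graph n) where
  open EdgeIdealOn G

  acyclic-step : ∀ {A s} → AcyclicOn G A → A s ≡ true → ∃ λ a → A a ≡ true × Step (ℐ A) a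
  acyclic-step acyclic As with leaf-or-isolated G acyclic As
  ... | inj₁ isolated           = _ , As , isolated⇒Step As isolated
  ... | inj₂ (_ , p , _ , leaf) = p , proj₁ (proj₂ leaf) , leaf⇒Step leaf

  dead⇒maximal : ∀ {A J} → (∀ i → A i ≡ false) → J ≐ ℐ A → IsMaximal J []
  dead⇒maximal dead J≐ (a , a∉J , _) = a∉J (proj₂ (J≐ (var a)) (dead⇒var∈ℐ (dead a)))

  acyclic⇒simple : ∀ {A J} → AcyclicOn G A → J ≐ ℐ A → Simple J
  acyclic⇒simple = go (<-wellFounded _)
    where
    go : ∀ {A J} → Acc _<_ (count A) → AcyclicOn G A → J ≐ ℐ A → Simple J
    go {A} (acc rec) acyclic J≐ with dead⊎alive A
    ... | inj₁ dead     = [] , _ , dead⇒maximal dead J≐ , ≐-trans J≐ (ℐ-dead≐maxIdeal dead)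
    ... | inj₂ (_ , As) with acyclic-step acyclic As
    ...   | a , Aa , step =
      Simple-∷ (Step-resp-≐ (≐-sym J≐) step)
        (go (rec (count-deleteN G Aa)) (AcyclicOn-antitone G (deleteN-⊆ G {a} {A}) acyclic)
            (≐-trans (∶-resp-≐ J≐ a) (ℐ-∶ Aa)))

  -- Every step of a spherical resolution is a domination by a leaf, which only flips
  -- the sign of χ; at the end no vertex is alive and χ = 1.
  spherical⇒χ≢0 : ∀ {A J as} → AcyclicOn G A → J ≐ ℐ A → IsRes SphStep J as → IsMaximal J as → χ G A ≢ 0ℤ
  spherical⇒χ≢0 {A} {as = []} acyclic J≐ _ maximal with dead⊎alive A
  ... | inj₁ dead = λ χ≡0 → 1≢0 (≡.trans (≡.sym (χ-dead G dead)) χ≡0)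
    where
    1≢0 : 1ℤ ≢ 0ℤ
    1≢0 ()
  ... | inj₂ (_ , As) with acyclic-step acyclic As
  ...   | a , _ , step = ⊥-elim (maximal (a , Step-resp-≐ (≐-sym J≐) step))
  spherical⇒χ≢0 {A} {as = a ∷ _} acyclic J≐ (sph , res) maximal χ≡0
    with SphStep⇒leaf (SphStep-resp-≐ J≐ sph)
  ... | l , leaf@(_ , Aa , _) =
    spherical⇒χ≢0 (AcyclicOn-antitone G (deleteN-⊆ G {a} {A}) acyclic) (≐-trans (∶-resp-≐ J≐ a) (ℐ-∶ Aa))
      res maximal (ℤₚ.neg-injective (≡.trans (≡.sym (χ-leaf G leaf)) χ≡0))

-- The tree tentacle

module Tentacle {n} {G : Graph n} {κ} (cc : IsComponentCount G κ) (h₁≡1 : κ + numEdges G ≡ suc n)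
                {k} {T : Graph k} (tn : TreeTentacle G T) where

  open TreeTentacle tn
  open CycleWalks C
  open EdgeIdealOn G

  private
    vw-adj : Adj G v w
    vw-adj = proj₁ vw

    vw∉C : ¬ CEdge C v w
    vw∉C = proj₂ vw

  in-K : ∀ t → ι t ≢ v → Star (AdjMinusCAvoid G C v) w (ι t)
  in-K t ιt≢v with proj₁ (image (ι t)) (t , refl)
  ... | inj₁ ιt≡v = ⊥-elim (ιt≢v ιt≡v)
  ... | inj₂ path = path

  -- A vertex u ≠ v of K on C would give a second cycle: w ⇝ u inside K, u ⇝ v along C,
  -- then the edge vw.
  off-cycle : ∀ t → ι t ≢ v → ∀ q → vert C q ≢ ι t
  off-cycle t ιt≢v q q≡ιt =
    only-cycle cc h₁≡1 C cstep-wrap vw-adj (∉C⇒≉CStep cstep-wrap vw∉C)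
      (Star.map from-K (in-K t ιt≢v) ◅◅
       subst (λ u → Star Avoiding u v) q≡ιt (Star.map from-C (around cstep-wrap q pos)))
    where
    Avoiding : Fin n → Fin n → Set
    Avoiding u u' = AdjExcept G (at (L C)) (at 0) u u' × ¬ SameEdge u u' v w
    from-K : ∀ {u u'} → AdjMinusCAvoid G C v u u' → Avoiding u u'
    from-K ((uu' , uu'∉C) , u≢v , u'≢v) =
      (uu' , ∉C⇒≉CStep cstep-wrap uu'∉C) ,
      λ { (inj₁ (u≡v , _)) → u≢v u≡v ; (inj₂ (_ , u'≡v)) → u'≢v u'≡v }
    from-C : ∀ {u u'} → CEdgeExcept (at (L C)) (at 0) u u' → Avoiding u u'
    from-C (uu'∈C , uu'≉) = (CEdge⇒Adj uu'∈C , uu'≉) , λ same → vw∉C (CEdge-resp-SameEdge same uu'∈C)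

  tentacle-edge∉C : ∀ {t t'} → Adj G (ι t) (ι t') → ¬ CEdge C (ι t) (ι t')
  tentacle-edge∉C {t} {t'} tt' e∈C with CEdge-ends e∈C | ι t ≟ v | ι t' ≟ v
  ... | (q , q≡) , _ | no ιt≢v  | _         = off-cycle t ιt≢v q q≡
  ... | _ , (q , q≡) | yes _    | no ιt'≢v  = off-cycle t' ιt'≢v q q≡
  ... | _            | yes ιt≡v | yes ιt'≡v = adj⇒≢ G tt' (≡.trans ιt≡v (≡.sym ιt'≡v))

  adj-ι : ∀ t t' → adj T t t' ≡ adj G (ι t) (ι t')
  adj-ι t t' with adj T t t' in tt'
  ... | true  = ≡.sym (proj₁ (proj₁ (edges t t') tt'))
  ... | false with adj G (ι t) (ι t') in ιtt'
  ...   | false = refl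
  ...   | true  = ⊥-elim (not-¬ (proj₂ (edges t t') (ιtt' , tentacle-edge∉C ιtt')) tt')

  Adj-ι⇒Adj : ∀ {t t'} → Adj G (ι t) (ι t') → Adj T t t'
  Adj-ι⇒Adj {t} {t'} = ≡.trans (adj-ι t t')

  Adj⇒Adj-ι : ∀ {t t'} → Adj T t t' → Adj G (ι t) (ι t')
  Adj⇒Adj-ι {t} {t'} = ≡.trans (≡.sym (adj-ι t t'))

  neighbour-in-tentacle : ∀ {b x} → ι b ≢ v → Adj G (ι b) x → ∃ λ t → ι t ≡ x × Adj T b t
  neighbour-in-tentacle {b} {x} ιb≢v bx =
    let t , ιt≡x = proj₂ (image x) x-in-image in t , ιt≡x , Adj-ι⇒Adj (subst (Adj G (ι b)) (≡.sym ιt≡x) bx)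
    where
    bx∉C : ¬ CEdge C (ι b) x
    bx∉C e∈C = let q , q≡ = proj₁ (CEdge-ends e∈C) in off-cycle b ιb≢v q q≡
    x-in-image : x ≡ v ⊎ Star (AdjMinusCAvoid G C v) w x
    x-in-image with x ≟ v
    ... | yes x≡v = inj₁ x≡v
    ... | no x≢v  = inj₂ (in-K b ιb≢v ◅◅ ((bx , bx∉C) , ιb≢v , x≢v) ◅ ε)

  tentacle-acyclic : ∀ A → AcyclicOn T A
  tentacle-acyclic A {x} {y} xy _ _ cycle =
    only-cycle cc h₁≡1 C cstep-wrap (Adj⇒Adj-ι xy) (off-C xy)
      (Star.gmap ι (λ (pq , _ , _ , pq≉xy) → (Adj⇒Adj-ι pq , off-C pq) , pq≉xy ∘ SameEdge-ι) cycle)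
    where
    off-C : ∀ {p q} → Adj T p q → ¬ SameEdge (ι p) (ι q) (at (L C)) (at 0)
    off-C pq = ∉C⇒≉CStep cstep-wrap (tentacle-edge∉C (Adj⇒Adj-ι pq))
    SameEdge-ι : ∀ {p q} → SameEdge (ι p) (ι q) (ι x) (ι y) → SameEdge p q x y
    SameEdge-ι (inj₁ (p≡ , q≡)) = inj₁ (ι-inj _ _ p≡ , ι-inj _ _ q≡)
    SameEdge-ι (inj₂ (p≡ , q≡)) = inj₂ (ι-inj _ _ p≡ , ι-inj _ _ q≡)

  acyclic-without-v : ∀ {A} → A v ≡ false → AcyclicOn G A
  acyclic-without-v {A} Av xy Ax Ay cycle =
    only-cycle cc h₁≡1 C (proj₂ (next pos)) xy (avoids-v Ax Ay)
      (Star.map (λ (pq , Ap , Aq , pq≉xy) → (pq , avoids-v Ap Aq) , pq≉xy) cycle)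
    where
    avoids-v : ∀ {p q u} → A p ≡ true → A q ≡ true → ¬ SameEdge p q v u
    avoids-v Ap _  (inj₁ (refl , _)) = not-¬ Ap Av
    avoids-v _  Aq (inj₂ (_ , refl)) = not-¬ Aq Av

  private
    tv : Fin k
    tv = proj₁ (proj₂ (image v) (inj₁ refl))

    ι-tv : ι tv ≡ v
    ι-tv = proj₂ (proj₂ (image v) (inj₁ refl))

    alive-tv : ∀ {A : Alive n} → A v ≡ true → A (ι tv) ≡ true
    alive-tv {A} = subst (λ u → A u ≡ true) (≡.sym ι-tv)

  deleteN-ι : ∀ p (A : Alive n) i → deleteN T p (A ∘ ι) i ≡ deleteN G (ι p) A (ι i)
  deleteN-ι p A i = cong₂ (λ d b → not d ∧ not b ∧ A (ι i)) does-≟-ι (adj-ι p i)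
    where
    does-≟-ι : does (p ≟ i) ≡ does (ι p ≟ ι i)
    does-≟-ι with p ≟ i
    ... | yes refl = ≡.sym (dec-true (ι p ≟ ι p) refl)
    ... | no p≢i   = ≡.sym (dec-false (ι p ≟ ι i) (p≢i ∘ ι-inj p i))

  leaf-ι : ∀ {A l p} → ι l ≢ v → LeafIn T (A ∘ ι) l p → LeafIn G A (ι l) (ι p)
  leaf-ι {A} {l} {p} ιl≢v (Al , Ap , pl , others-dead) = Al , Ap , Adj⇒Adj-ι pl , others-dead′
    where
    others-dead′ : ∀ z → Adj G (ι l) z → z ≢ ι p → A z ≡ false
    others-dead′ z lz z≢ιp with neighbour-in-tentacle ιl≢v lz
    ... | t , refl , lt = others-dead t lt (z≢ιp ∘ cong ι)

  -- While v is alive, χ ≢ 0 forbids v from being isolated in the tentacle, so the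
  -- tentacle has a leaf l ≠ v whose neighbour dominates it in the whole graph.
  tentacle-phase : ∀ {A J} → A v ≡ true → χ T (A ∘ ι) ≢ 0ℤ → J ≐ ℐ A → Simple J
  tentacle-phase = go (<-wellFounded _)
    where
    go : ∀ {A J} → Acc _<_ (count A) → A v ≡ true → χ T (A ∘ ι) ≢ 0ℤ → J ≐ ℐ A → Simple J
    go {A} {J} (acc rec) Av χ≢0 J≐
      with leaf-or-isolated T (tentacle-acyclic (A ∘ ι)) {s = tv} (alive-tv {A} Av)
    ... | inj₁ isolated = ⊥-elim (χ≢0 (χ-isolated T (alive-tv {A} Av) isolated))
    ... | inj₂ (l , p , l≢tv , leaf@(_ , Ap , _)) =
      Simple-∷ (Step-resp-≐ (≐-sym J≐) (leaf⇒Step (leaf-ι ιl≢v leaf))) rest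
      where
      ιl≢v : ι l ≢ v
      ιl≢v ιl≡v = l≢tv (ι-inj l tv (≡.trans ιl≡v (≡.sym ι-tv)))
      A′ : Alive n
      A′ = deleteN G (ι p) A
      J′≐ : (J ∶ ι p) ≐ ℐ A′
      J′≐ = ≐-trans (∶-resp-≐ J≐ (ι p)) (ℐ-∶ Ap)
      χ′≢0 : χ T (A′ ∘ ι) ≢ 0ℤ
      χ′≢0 χ′≡0 = χ≢0 (begin
        χ T (A ∘ ι)                  ≡⟨ χ-leaf T leaf ⟩
        - χ T (deleteN T p (A ∘ ι))  ≡⟨ cong -_ (χ-cong T (deleteN-ι p A)) ⟩
        - χ T (A′ ∘ ι)               ≡⟨ cong -_ χ′≡0 ⟩
        0ℤ                           ∎)
        where open ≡.≡-Reasoning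
      rest : Simple (J ∶ ι p)
      rest with A′ v in A′v
      ... | true  = go (rec (count-deleteN G Ap)) A′v χ′≢0 J′≐
      ... | false = acyclic⇒simple G (acyclic-without-v A′v) J′≐

lemma7p4 : ∀ {n} (G : Graph n) (κ : ℕ) → IsComponentCount G κ → κ + numEdges G ≡ suc n →
    ∀ {k} (T : Graph k) → TreeTentacle G T → Spherical (edgeIdeal T) → Simple (edgeIdeal G)
lemma7p4 G κ cc h₁≡1 T tn (_ , res , maximal) =
  tentacle-phase refl
    (spherical⇒χ≢0 T (tentacle-acyclic _) (EdgeIdealOn.edgeIdeal≐ℐ T) res maximal)
    (EdgeIdealOn.edgeIdeal≐ℐ G)
  where open Tentacle cc h₁≡1 tn
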